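{- Let $p$ be a prime, $m$ a positive integer and $r$ an integer with $r^p\equiv 1 \pmod m$ and $\gcd(p(r-1),m)=1$, and let $G=\langle x,y \mid x^p=y^m=1,\ x^{ -1}yx=y^r\rangle\cong C_p\ltimes C_m$ (of order $pm$), where $p$ is the smallest prime divisor of $|G|$; let $N=\langle y\rangle$. Fix integers $t\in[1,p]$ and $0=k_1<k_2<\cdots<k_t\le p-1$. Let $\mathbf A=(A_1,\ldots,A_\ell)$ be a sequence of subsets of $N$ with $A_i=\{u_i^{r^{k_1}},u_i^{r^{k_2}},\ldots,u_i^{r^{k_t}}\}$ for some $u_i\in N$ ($i\in[1,\ell]$). Let $v\in[2,\ell+1]$, let $M=\operatorname{stab}(\Pi^{v-1}(\mathbf A))$, let $I_M=\{i\in[1,\ell]: A_i\subseteq M\}$, for each coset $Q\in N/M$ let $V_Q=\{i\in[1,\ell]: A_i\cap Q\ne\emptyset\}$, and let $\mu=|\{Q\in N/M: |V_Q|\ge v\}|$. Then: (i) $V_M=I_M$; moreover, if $Q\in N/M$ with $Q\ne M$, then $V_Q\cap V_M=\emptyset$. (ii) If $Q\in N/M$, $Q\neq M$, and $i\in V_Q$, then the $t$ elements of $A_i$ are distinct and lie in $t$ different cosets of $M$. (iii) If $t=p$, $\mu=1$, and $R$ is the unique coset of $M$ with $|V_R|\ge v$, then $R=M$.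
   Context: $N$ is abelian (cyclic). For $k\le\ell$, $\Pi^k(\mathbf A)=\{a_{i_1}\cdots a_{i_k}: 1\le i_1<\cdots<i_k\le\ell,\ a_{i_j}\in A_{i_j}\}$. For a subset $X$ of $N$, $\operatorname{stab}(X)=\{g\in N: gX=X\}$. $[a,b]$ denotes the set of integers between $a$ and $b$ inclusive. -}

module Defs where

open import Data.Nat as ℕ using (ℕ; zero; suc; NonZero; _∸_)
open import Data.Nat.DivMod using (_mod_)
open import Data.Integer as ℤ using (ℤ; +_)
open import Data.Integer.DivMod using (_%ℕ_)
open import Data.Fin as Fin using (Fin; toℕ)
open import Data.Product using (Σ; ∃; _×_; _,_)
open import Relation.Binary.PropositionalEquality using (_≡_)
open import Function using (_∘_)
open import Function.Definitions using (Injective)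

-- The cyclic group N = ⟨y⟩ ≅ C_m is modelled additively as ℤ/mℤ = Fin m:
-- the element y^a is represented by (a mod m).  Subsets of N are predicates.
module _ (m : ℕ) {{_ : NonZero m}} where

  _⊕_ : Fin m → Fin m → Fin m
  a ⊕ b = (toℕ a ℕ.+ toℕ b) mod m

  e : Fin m
  e = 0 mod m

  ⊖ : Fin m → Fin m
  ⊖ a = (m ∸ toℕ a) mod m

  -- u ↦ u^(r^k) : y^a ↦ y^(a r^k)
  pw : ℤ → ℕ → Fin m → Fin m
  pw r k u = ((+ toℕ u ℤ.* (r ℤ.^ k)) %ℕ m) mod m

  sumN : ∀ {n} → (Fin n → Fin m) → Fin m
  sumN {zero}  a = e
  sumN {suc n} a = a Fin.zero ⊕ sumN (a ∘ Fin.suc)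

  Pred : Set₁
  Pred = Fin m → Set

  Π : (ℓ : ℕ) → (Fin ℓ → Pred) → ℕ → Pred
  Π ℓ A n x = Σ (Fin n → Fin ℓ) λ s →
                (∀ i j → i Fin.< j → s i Fin.< s j) ×
                Σ (Fin n → Fin m) λ a → (∀ j → A (s j) (a j)) × (x ≡ sumN a)

  stab : Pred → Pred
  stab X g = ∀ x → (X x → X (g ⊕ x)) × (X x → Σ (Fin m) λ y → X y × (g ⊕ y ≡ x))

  coset : Pred → Fin m → Pred
  coset M g x = M (x ⊕ ⊖ g)

  SameSet : Pred → Pred → Set
  SameSet P Q = ∀ x → (P x → Q x) × (Q x → P x)

  Aset : ℤ → (t : ℕ) → (Fin t → ℕ) → (ℓ : ℕ) → (Fin ℓ → Fin m) → Fin ℓ → Pred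
  Aset r t k ℓ u i x = ∃ λ (j : Fin t) → x ≡ pw r (k j) (u i)

AtLeast : (ℓ : ℕ) → (Fin ℓ → Set) → ℕ → Set
AtLeast ℓ V v = Σ (Fin v → Fin ℓ) λ f → Injective _≡_ _≡_ f × (∀ j → V (f j))

module Submission where

-- Write N = ⟨y⟩ additively as ℤ/mℤ. The stabiliser M of any subset of N is a subgroup, so its
-- preimage in ℤ is an additive subgroup containing mℤ, and every claim becomes a congruence
-- modulo m. From r^p ≡ 1 and r - 1 being a unit, every r^d - 1 with 0 < d < p is a unit, so for
-- u ∉ M the elements u r^(k_j) lie in pairwise different cosets of M, while one of them lies in M
-- only if u does; this gives (i) and (ii). When t = p, multiplication by r permutes each A_i, so it
-- maps V_{gM} into V_{g^r M}; uniqueness of the heavy coset gives g^(r-1) ∈ M, hence g ∈ M.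

open import Defs
open import Data.Nat as ℕ using (ℕ; zero; suc; NonZero; _≤_; _<_; _∸_)
open import Data.Nat.Divisibility as ℕD using ()
open import Data.Nat.Primality using (Prime; prime⇒nonZero)
open import Data.Integer as ℤ using (ℤ; +_; 1ℤ)
open import Data.Integer.Divisibility as ℤD using ()
open import Data.Integer.GCD as ℤG using ()
open import Data.Fin as Fin using (Fin; toℕ)
open import Data.Product using (Σ; ∃; _×_; _,_; proj₁; proj₂)
open import Relation.Binary.PropositionalEquality using (_≡_)
open import Relation.Nullary using (¬_; contradiction; yes; no)

open import Data.Fin.Properties as Fin using ()
open import Data.Integer.Base using (0ℤ; -_; _+_; _-_; _*_; _^_; ∣_∣; _%ℕ_; _/ℕ_)
open import Data.Integer.DivMod using (a≡a%ℕn+[a/ℕn]*n)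
open import Data.Integer.Divisibility.Signed
  using (_∣_; divides; ∣m⇒∣-m; ∣m∣n⇒∣m+n; ∣n⇒∣m*n; ∣m⇒∣m*n; ∣ᵤ⇒∣; ∣⇒∣ᵤ)
open import Data.Integer.Properties as ℤ using ()
open import Data.Integer.Tactic.RingSolver using (solve-∀)
open import Data.Nat.Coprimality using (Coprime; coprime-Bézout; gcd≡1⇒coprime; prime⇒coprime)
open import Data.Nat.DivMod using (_mod_; _%_; _/_; m≡m%n+[m/n]*n; m%n<n)
open import Data.Nat.GCD using (module Bézout)
open import Data.Nat.Properties as ℕ using ()
open import Data.Sum using (inj₁; inj₂)
open import Function using (_∘_; _$_)
open import Level using (0ℓ)
open import Relation.Binary.Bundles using (Setoid)
open import Relation.Binary.Definitions using (Reflexive; Symmetric; Transitive; tri<; tri≈; tri>)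
open import Relation.Binary.PropositionalEquality
  using (refl; sym; trans; cong; cong₂; subst; module ≡-Reasoning)
import Relation.Binary.Reasoning.Setoid as SetoidReasoning

1+ab≡cd : ∀ a b c d → 1 ℕ.+ a ℕ.* b ≡ c ℕ.* d → 1ℤ + + a * + b ≡ + c * + d
1+ab≡cd a b c d eq = begin
  1ℤ + + a * + b      ≡⟨ cong (_+_ 1ℤ) (ℤ.pos-* a b) ⟨
  + (1 ℕ.+ a ℕ.* b)   ≡⟨ cong +_ eq ⟩
  + (c ℕ.* d)         ≡⟨ ℤ.pos-* c d ⟩
  + c * + d           ∎
  where open ≡-Reasoning

multiple-below⇒0 : ∀ {m d} → m ℕD.∣ d → d < m → d ≡ 0
multiple-below⇒0 {d = zero}  _   _   = refl
multiple-below⇒0 {d = suc _} m∣d d<m = contradiction m∣d (ℕD.>⇒∤ d<m)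

geometric : ℤ → ℕ → ℤ
geometric a zero    = 0ℤ
geometric a (suc n) = 1ℤ + a * geometric a n

geometric-sum : ∀ a n → (a - 1ℤ) * geometric a n ≡ a ^ n - 1ℤ
geometric-sum a zero    = ℤ.*-zeroʳ (a - 1ℤ)
geometric-sum a (suc n) = begin
  (a - 1ℤ) * (1ℤ + a * geometric a n)       ≡⟨ distribute a (geometric a n) ⟩
  a * ((a - 1ℤ) * geometric a n) + (a - 1ℤ) ≡⟨ cong (λ z → a * z + (a - 1ℤ)) (geometric-sum a n) ⟩
  a * (a ^ n - 1ℤ) + (a - 1ℤ)               ≡⟨ collect a (a ^ n) ⟩
  a * a ^ n - 1ℤ                            ∎
  where
  open ≡-Reasoning
  distribute : ∀ a g → (a - 1ℤ) * (1ℤ + a * g) ≡ a * ((a - 1ℤ) * g) + (a - 1ℤ)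
  distribute = solve-∀
  collect : ∀ a h → a * (h - 1ℤ) + (a - 1ℤ) ≡ a * h - 1ℤ
  collect = solve-∀

StrictlyIncreasing : ∀ {n} → (Fin n → ℕ) → Set
StrictlyIncreasing f = ∀ i j → i Fin.< j → f i < f j

strictlyIncreasing-tail : ∀ {n} {f : Fin (suc n) → ℕ} →
                          StrictlyIncreasing f → StrictlyIncreasing (f ∘ Fin.suc)
strictlyIncreasing-tail inc i j i<j = inc (Fin.suc i) (Fin.suc j) (ℕ.s≤s i<j)

strictlyIncreasing-lowerBound : ∀ {n} {f : Fin (suc n) → ℕ} → StrictlyIncreasing f →
                                ∀ j → f Fin.zero ℕ.+ toℕ j ≤ f j
strictlyIncreasing-lowerBound {f = f} inc Fin.zero = ℕ.≤-reflexive (ℕ.+-identityʳ (f Fin.zero))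
strictlyIncreasing-lowerBound {suc n} {f} inc (Fin.suc j) = begin
  f Fin.zero ℕ.+ suc (toℕ j)     ≡⟨ ℕ.+-suc (f Fin.zero) (toℕ j) ⟩
  suc (f Fin.zero) ℕ.+ toℕ j     ≤⟨ ℕ.+-monoˡ-≤ (toℕ j) (inc Fin.zero (Fin.suc Fin.zero) (ℕ.s≤s ℕ.z≤n)) ⟩
  f (Fin.suc Fin.zero) ℕ.+ toℕ j ≤⟨ strictlyIncreasing-lowerBound (strictlyIncreasing-tail inc) j ⟩
  f (Fin.suc j)                  ∎
  where open ℕ.≤-Reasoning

strictlyIncreasing-head : ∀ {n} a {f : Fin (suc n) → ℕ} → StrictlyIncreasing f →
                          (∀ j → a ≤ f j) → (∀ j → f j < a ℕ.+ suc n) → f Fin.zero ≡ a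
strictlyIncreasing-head {n} a {f} inc lo hi = ℕ.≤-antisym
  (ℕ.+-cancelʳ-≤ n (f Fin.zero) a (ℕ.s≤s⁻¹ (subst (f Fin.zero ℕ.+ n <_) (ℕ.+-suc a n) f₀+n<a+1+n)))
  (lo Fin.zero)
  where
  f₀+n<a+1+n : f Fin.zero ℕ.+ n < a ℕ.+ suc n
  f₀+n<a+1+n = begin-strict
    f Fin.zero ℕ.+ n                 ≡⟨ cong (f Fin.zero ℕ.+_) (Fin.toℕ-fromℕ n) ⟨
    f Fin.zero ℕ.+ toℕ (Fin.fromℕ n) ≤⟨ strictlyIncreasing-lowerBound inc (Fin.fromℕ n) ⟩
    f (Fin.fromℕ n)                  <⟨ hi (Fin.fromℕ n) ⟩
    a ℕ.+ suc n                      ∎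
    where open ℕ.≤-Reasoning

strictlyIncreasing-interval : ∀ {n} a {f : Fin n → ℕ} → StrictlyIncreasing f →
                              (∀ j → a ≤ f j) → (∀ j → f j < a ℕ.+ n) → ∀ j → f j ≡ a ℕ.+ toℕ j
strictlyIncreasing-interval {suc n} a {f} inc lo hi Fin.zero =
  trans (strictlyIncreasing-head a inc lo hi) (sym (ℕ.+-identityʳ a))
strictlyIncreasing-interval {suc n} a {f} inc lo hi (Fin.suc j) = begin
  f (Fin.suc j)        ≡⟨ strictlyIncreasing-interval (suc a) (strictlyIncreasing-tail inc) lo′ hi′ j ⟩
  suc a ℕ.+ toℕ j      ≡⟨ ℕ.+-suc a (toℕ j) ⟨
  a ℕ.+ suc (toℕ j)    ∎
  where
  open ≡-Reasoning
  lo′ : ∀ j → suc a ≤ f (Fin.suc j)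
  lo′ j = subst (_< f (Fin.suc j)) (strictlyIncreasing-head a inc lo hi)
                (inc Fin.zero (Fin.suc j) (ℕ.s≤s ℕ.z≤n))
  hi′ : ∀ j → f (Fin.suc j) < suc a ℕ.+ n
  hi′ j = subst (f (Fin.suc j) <_) (ℕ.+-suc a n) (hi (Fin.suc j))

module Congruence (m : ℕ) {{_ : NonZero m}} where

  infix 4 _≈_
  record _≈_ (a b : ℤ) : Set where
    constructor congruent
    field divides-difference : + m ∣ a - b

  ≈-by-quotient : ∀ {a b} q → a ≡ b + q * + m → a ≈ b
  ≈-by-quotient {b = b} q refl = congruent (divides q (cancel b q (+ m)))
    where
    cancel : ∀ b q m → b + q * m - b ≡ q * m
    cancel = solve-∀

  ≡⇒≈ : ∀ {a b} → a ≡ b → a ≈ b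
  ≡⇒≈ {a} refl = ≈-by-quotient 0ℤ (add-zero a (+ m))
    where
    add-zero : ∀ a m → a ≡ a + 0ℤ * m
    add-zero = solve-∀

  ≈-refl : Reflexive _≈_
  ≈-refl = ≡⇒≈ refl

  ≈-sym : Symmetric _≈_
  ≈-sym {a} {b} (congruent m∣a-b) = congruent $ subst (+ m ∣_) (swap a b) (∣m⇒∣-m m∣a-b)
    where
    swap : ∀ a b → - (a - b) ≡ b - a
    swap = solve-∀

  ≈-trans : Transitive _≈_
  ≈-trans {a} {b} {c} (congruent m∣a-b) (congruent m∣b-c) =
    congruent $ subst (+ m ∣_) (telescope a b c) (∣m∣n⇒∣m+n m∣a-b m∣b-c)
    where
    telescope : ∀ a b c → (a - b) + (b - c) ≡ a - c
    telescope = solve-∀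

  ≈-setoid : Setoid 0ℓ 0ℓ
  ≈-setoid = record
    { Carrier       = ℤ
    ; _≈_           = _≈_
    ; isEquivalence = record { refl = ≈-refl ; sym = ≈-sym ; trans = ≈-trans }
    }

  module ≈-Reasoning = SetoidReasoning ≈-setoid

  +-cong : ∀ {a a′ b b′} → a ≈ a′ → b ≈ b′ → a + b ≈ a′ + b′
  +-cong {a} {a′} {b} {b′} (congruent m∣a-a′) (congruent m∣b-b′) =
    congruent $ subst (+ m ∣_) (regroup a a′ b b′) (∣m∣n⇒∣m+n m∣a-a′ m∣b-b′)
    where
    regroup : ∀ a a′ b b′ → (a - a′) + (b - b′) ≡ (a + b) - (a′ + b′)
    regroup = solve-∀

  *-cong : ∀ {a a′ b b′} → a ≈ a′ → b ≈ b′ → a * b ≈ a′ * b′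
  *-cong {a} {a′} {b} {b′} (congruent m∣a-a′) (congruent m∣b-b′) =
    congruent $ subst (+ m ∣_) (regroup a a′ b b′)
                      (∣m∣n⇒∣m+n (∣m⇒∣m*n b m∣a-a′) (∣n⇒∣m*n a′ m∣b-b′))
    where
    regroup : ∀ a a′ b b′ → (a - a′) * b + a′ * (b - b′) ≡ a * b - a′ * b′
    regroup = solve-∀

  +-congˡ : ∀ a {b b′} → b ≈ b′ → a + b ≈ a + b′
  +-congˡ a = +-cong (≈-refl {a})

  +-congʳ : ∀ b {a a′} → a ≈ a′ → a + b ≈ a′ + b
  +-congʳ b a≈a′ = +-cong a≈a′ (≈-refl {b})

  *-congˡ : ∀ a {b b′} → b ≈ b′ → a * b ≈ a * b′
  *-congˡ a = *-cong (≈-refl {a})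

  *-congʳ : ∀ b {a a′} → a ≈ a′ → a * b ≈ a′ * b
  *-congʳ b a≈a′ = *-cong a≈a′ (≈-refl {b})

  neg-cong : ∀ {a b} → a ≈ b → - a ≈ - b
  neg-cong {a} {b} (congruent m∣a-b) = congruent $ subst (+ m ∣_) (distribute a b) (∣m⇒∣-m m∣a-b)
    where
    distribute : ∀ a b → - (a - b) ≡ - a - - b
    distribute = solve-∀

  ^-cong : ∀ {a b} n → a ≈ b → a ^ n ≈ b ^ n
  ^-cong zero    a≈b = ≈-refl
  ^-cong (suc n) a≈b = *-cong a≈b (^-cong n a≈b)

  ≈-%ℕ : ∀ a → a ≈ + (a %ℕ m)
  ≈-%ℕ a = ≈-by-quotient (a /ℕ m) (a≡a%ℕn+[a/ℕn]*n a m)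

  IsUnit : ℤ → Set
  IsUnit a = ∃ λ c → c * a ≈ 1ℤ

  unit-resp : ∀ {a b} → a ≈ b → IsUnit a → IsUnit b
  unit-resp a≈b (c , ca≈1) = c , ≈-trans (*-congˡ c (≈-sym a≈b)) ca≈1

  unit-* : ∀ {a b} → IsUnit a → IsUnit b → IsUnit (a * b)
  unit-* {a} {b} (c , ca≈1) (d , db≈1) = d * c , (begin
    d * c * (a * b)   ≡⟨ regroup a b c d ⟩
    d * ((c * a) * b) ≈⟨ *-congˡ d (*-congʳ b ca≈1) ⟩
    d * (1ℤ * b)      ≡⟨ cong (d *_) (ℤ.*-identityˡ b) ⟩
    d * b             ≈⟨ db≈1 ⟩
    1ℤ                ∎)
    where
    open ≈-Reasoning
    regroup : ∀ a b c d → d * c * (a * b) ≡ d * ((c * a) * b)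
    regroup = solve-∀

  unit-neg : ∀ {a} → IsUnit a → IsUnit (- a)
  unit-neg {a} (c , ca≈1) = - c , ≈-trans (≡⇒≈ (neg*neg c a)) ca≈1
    where
    neg*neg : ∀ c a → - c * - a ≡ c * a
    neg*neg = solve-∀

  unit-^ : ∀ {a} → IsUnit a → ∀ n → IsUnit (a ^ n)
  unit-^ a-unit zero    = 1ℤ , ≈-refl
  unit-^ a-unit (suc n) = unit-* a-unit (unit-^ a-unit n)

  unit-factorʳ : ∀ a {b} → IsUnit (a * b) → IsUnit b
  unit-factorʳ a {b} (c , cab≈1) = c * a , ≈-trans (≡⇒≈ (ℤ.*-assoc c a b)) cab≈1

  bézout⇒unit : ∀ {n} → Bézout.Identity 1 n m → IsUnit (+ n)
  bézout⇒unit {n} (Bézout.+- x y 1+ym≡xn) =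
    + x , ≈-by-quotient (+ y) (sym (1+ab≡cd y m x n 1+ym≡xn))
  bézout⇒unit {n} (Bézout.-+ x y 1+xn≡ym) =
    - + x , ≈-by-quotient (- + y) (negate (+ x) (+ n) (+ y) (+ m) (1+ab≡cd x n y m 1+xn≡ym))
    where
    negate : ∀ x n y m → 1ℤ + x * n ≡ y * m → - x * n ≡ 1ℤ + - y * m
    negate x n y m eq = trans (isolate x n) (trans (cong (_-_ 1ℤ) eq) (regroup y m))
      where
      isolate : ∀ a b → - a * b ≡ 1ℤ - (1ℤ + a * b)
      isolate = solve-∀
      regroup : ∀ a b → 1ℤ - a * b ≡ 1ℤ + - a * b
      regroup = solve-∀

  coprime⇒unit : ∀ {a} → Coprime ∣ a ∣ m → IsUnit a
  coprime⇒unit {a} coprime with ℤ.+∣i∣≡i⊎+∣i∣≡-i a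
  ... | inj₁ ∣a∣≡a  = subst IsUnit ∣a∣≡a (bézout⇒unit (coprime-Bézout coprime))
  ... | inj₂ ∣a∣≡-a = subst IsUnit (ℤ.neg-involutive a)
                        (unit-neg (subst IsUnit ∣a∣≡-a (bézout⇒unit (coprime-Bézout coprime))))

  record IsSubmonoid (P : ℤ → Set) : Set where
    field
      resp     : ∀ {a b} → a ≈ b → P a → P b
      0∈       : P 0ℤ
      +-closed : ∀ {a b} → P a → P b → P (a + b)

    ℕ*-closed : ∀ n {a} → P a → P (+ n * a)
    ℕ*-closed zero    {a} Pa = resp (≡⇒≈ (sym (ℤ.*-zeroˡ a))) 0∈
    ℕ*-closed (suc n) {a} Pa = resp (≡⇒≈ (collect (+ n) a)) (+-closed Pa (ℕ*-closed n Pa))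
      where
      collect : ∀ n a → a + n * a ≡ (1ℤ + n) * a
      collect = solve-∀

    *-closed : ∀ c {a} → P a → P (c * a)
    *-closed c {a} Pa = resp (*-congʳ a (≈-sym (≈-%ℕ c))) (ℕ*-closed (c %ℕ m) Pa)

    neg-closed : ∀ {a} → P a → P (- a)
    neg-closed {a} Pa = resp (≡⇒≈ (ℤ.-1*i≡-i a)) (*-closed (- 1ℤ) Pa)

    −-closed : ∀ {a b} → P a → P b → P (a - b)
    −-closed Pa Pb = +-closed Pa (neg-closed Pb)

    unit-cancel : ∀ {c a} → IsUnit c → P (c * a) → P a
    unit-cancel {c} {a} (d , dc≈1) Pca = resp d[ca]≈a (*-closed d Pca)
      where
      open ≈-Reasoning
      d[ca]≈a : d * (c * a) ≈ a
      d[ca]≈a = begin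
        d * (c * a) ≡⟨ ℤ.*-assoc d c a ⟨
        d * c * a   ≈⟨ *-congʳ a dc≈1 ⟩
        1ℤ * a      ≡⟨ ℤ.*-identityˡ a ⟩
        a           ∎

module Residues (m : ℕ) {{_ : NonZero m}} where
  open Congruence m

  infixl 6 _·_
  _·_ : Fin m → Fin m → Fin m
  _·_ = _⊕_ m

  toℤ : Fin m → ℤ
  toℤ x = + toℕ x

  fromℤ : ℤ → Fin m
  fromℤ a = (a %ℕ m) mod m

  toℤ-mod : ∀ n → toℤ (n mod m) ≈ + n
  toℤ-mod n = ≈-sym (≈-by-quotient (+ (n / m)) (begin
    + n                             ≡⟨ cong +_ (m≡m%n+[m/n]*n n m) ⟩
    + (n % m ℕ.+ n / m ℕ.* m)       ≡⟨ ℤ.pos-+ (n % m) _ ⟩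
    + (n % m) + + (n / m ℕ.* m)     ≡⟨ cong₂ _+_ (cong +_ (sym (Fin.toℕ-fromℕ< (m%n<n n m))))
                                                 (ℤ.pos-* (n / m) m) ⟩
    toℤ (n mod m) + + (n / m) * + m ∎))
    where open ≡-Reasoning

  toℤ-fromℤ : ∀ a → toℤ (fromℤ a) ≈ a
  toℤ-fromℤ a = ≈-trans (toℤ-mod (a %ℕ m)) (≈-sym (≈-%ℕ a))

  toℤ-injective : ∀ {x y} → toℤ x ≈ toℤ y → x ≡ y
  toℤ-injective {x} {y} (congruent m∣x-y) =
    Fin.toℕ-injective (ℤ.+-injective (ℤ.i-j≡0⇒i≡j _ _ (ℤ.∣i∣≡0⇒i≡0 ∣x-y∣≡0)))
    where
    ∣x-y∣<m : ∣ toℤ x - toℤ y ∣ < m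
    ∣x-y∣<m = begin-strict
      ∣ toℤ x - toℤ y ∣       ≡⟨ cong ∣_∣ (ℤ.m-n≡m⊖n (toℕ x) (toℕ y)) ⟩
      ∣ toℕ x ℤ.⊖ toℕ y ∣     ≤⟨ ℤ.∣m⊝n∣≤m⊔n (toℕ x) (toℕ y) ⟩
      toℕ x ℕ.⊔ toℕ y         <⟨ ℕ.⊔-pres-<m (Fin.toℕ<n x) (Fin.toℕ<n y) ⟩
      m                       ∎
      where open ℕ.≤-Reasoning
    ∣x-y∣≡0 : ∣ toℤ x - toℤ y ∣ ≡ 0
    ∣x-y∣≡0 = multiple-below⇒0 (∣⇒∣ᵤ m∣x-y) ∣x-y∣<m

  fromℤ-cong : ∀ {a b} → a ≈ b → fromℤ a ≡ fromℤ b
  fromℤ-cong {a} {b} a≈b = toℤ-injective (begin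
    toℤ (fromℤ a) ≈⟨ toℤ-fromℤ a ⟩
    a             ≈⟨ a≈b ⟩
    b             ≈⟨ toℤ-fromℤ b ⟨
    toℤ (fromℤ b) ∎)
    where open ≈-Reasoning

  fromℤ-toℤ : ∀ x → fromℤ (toℤ x) ≡ x
  fromℤ-toℤ x = toℤ-injective (toℤ-fromℤ (toℤ x))

  toℤ-· : ∀ x y → toℤ (x · y) ≈ toℤ x + toℤ y
  toℤ-· x y = ≈-trans (toℤ-mod _) (≡⇒≈ (ℤ.pos-+ (toℕ x) (toℕ y)))

  toℤ-e : toℤ (e m) ≈ 0ℤ
  toℤ-e = toℤ-mod 0

  toℤ-⊖ : ∀ x → toℤ (⊖ m x) ≈ - toℤ x
  toℤ-⊖ x = begin
    toℤ (⊖ m x)      ≈⟨ toℤ-mod (m ∸ toℕ x) ⟩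
    + (m ∸ toℕ x)    ≡⟨ trans (ℤ.m-n≡m⊖n m (toℕ x)) (ℤ.⊖-≥ (ℕ.<⇒≤ (Fin.toℕ<n x))) ⟨
    + m - toℤ x      ≈⟨ ≈-by-quotient 1ℤ (regroup (+ m) (toℤ x)) ⟩
    - toℤ x          ∎
    where
    open ≈-Reasoning
    regroup : ∀ m x → m - x ≡ - x + 1ℤ * m
    regroup = solve-∀

  fromℤ-0 : fromℤ 0ℤ ≡ e m
  fromℤ-0 = toℤ-injective (≈-trans (toℤ-fromℤ 0ℤ) (≈-sym toℤ-e))

  fromℤ-+ : ∀ a b → fromℤ (a + b) ≡ fromℤ a · fromℤ b
  fromℤ-+ a b = toℤ-injective (begin
    toℤ (fromℤ (a + b))           ≈⟨ toℤ-fromℤ (a + b) ⟩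
    a + b                         ≈⟨ +-cong (toℤ-fromℤ a) (toℤ-fromℤ b) ⟨
    toℤ (fromℤ a) + toℤ (fromℤ b) ≈⟨ toℤ-· (fromℤ a) (fromℤ b) ⟨
    toℤ (fromℤ a · fromℤ b)       ∎)
    where open ≈-Reasoning

  fromℤ-− : ∀ x g → x · ⊖ m g ≡ fromℤ (toℤ x - toℤ g)
  fromℤ-− x g = toℤ-injective (begin
    toℤ (x · ⊖ m g)             ≈⟨ toℤ-· x (⊖ m g) ⟩
    toℤ x + toℤ (⊖ m g)         ≈⟨ +-congˡ (toℤ x) (toℤ-⊖ g) ⟩
    toℤ x - toℤ g               ≈⟨ toℤ-fromℤ (toℤ x - toℤ g) ⟨
    toℤ (fromℤ (toℤ x - toℤ g)) ∎)
    where open ≈-Reasoning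

  ·-identityˡ : ∀ x → e m · x ≡ x
  ·-identityˡ x = toℤ-injective (begin
    toℤ (e m · x)     ≈⟨ toℤ-· (e m) x ⟩
    toℤ (e m) + toℤ x ≈⟨ +-congʳ (toℤ x) toℤ-e ⟩
    0ℤ + toℤ x        ≡⟨ ℤ.+-identityˡ (toℤ x) ⟩
    toℤ x             ∎)
    where open ≈-Reasoning

  ·-assoc : ∀ x y z → (x · y) · z ≡ x · (y · z)
  ·-assoc x y z = toℤ-injective (begin
    toℤ ((x · y) · z)       ≈⟨ toℤ-· (x · y) z ⟩
    toℤ (x · y) + toℤ z     ≈⟨ +-congʳ (toℤ z) (toℤ-· x y) ⟩
    toℤ x + toℤ y + toℤ z   ≡⟨ ℤ.+-assoc (toℤ x) (toℤ y) (toℤ z) ⟩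
    toℤ x + (toℤ y + toℤ z) ≈⟨ +-congˡ (toℤ x) (toℤ-· y z) ⟨
    toℤ x + toℤ (y · z)     ≈⟨ toℤ-· x (y · z) ⟨
    toℤ (x · (y · z))       ∎)
    where open ≈-Reasoning

module Stabiliser (m : ℕ) {{_ : NonZero m}} (X : Pred m) where
  open Congruence m
  open Residues m

  stab-e : stab m X (e m)
  stab-e x = subst X (sym (·-identityˡ x)) , λ Xx → x , Xx , ·-identityˡ x

  stab-· : ∀ {g h} → stab m X g → stab m X h → stab m X (g · h)
  stab-· {g} {h} gX≡X hX≡X x = gh[X]⊆X , X⊆gh[X]
    where
    gh[X]⊆X : X x → X ((g · h) · x)
    gh[X]⊆X Xx = subst X (sym (·-assoc g h x)) (proj₁ (gX≡X (h · x)) (proj₁ (hX≡X x) Xx))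
    X⊆gh[X] : X x → Σ (Fin m) λ z → X z × ((g · h) · z ≡ x)
    X⊆gh[X] Xx with proj₂ (gX≡X x) Xx
    ... | y , Xy , gy≡x with proj₂ (hX≡X y) Xy
    ... | z , Xz , hz≡y = z , Xz , trans (·-assoc g h z) (trans (cong (g ·_) hz≡y) gy≡x)

  -- The preimage of stab X in ℤ; a record rather than a function so that its index is inferable.
  record Stabℤ (a : ℤ) : Set where
    constructor reduce
    field reduced : stab m X (fromℤ a)
  open Stabℤ public

  Stabℤ-isSubmonoid : IsSubmonoid Stabℤ
  Stabℤ-isSubmonoid = record
    { resp     = λ a≈b (reduce s) → reduce (subst (stab m X) (fromℤ-cong a≈b) s)
    ; 0∈       = reduce (subst (stab m X) (sym fromℤ-0) stab-e)
    ; +-closed = λ {a} {b} (reduce sa) (reduce sb) →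
                   reduce (subst (stab m X) (sym (fromℤ-+ a b)) (stab-· sa sb))
    }

  stab⇒Stabℤ : ∀ g → stab m X g → Stabℤ (toℤ g)
  stab⇒Stabℤ g s = reduce (subst (stab m X) (sym (fromℤ-toℤ g)) s)

  Stabℤ⇒stab : ∀ g → Stabℤ (toℤ g) → stab m X g
  Stabℤ⇒stab g (reduce s) = subst (stab m X) (fromℤ-toℤ g) s

  coset⇒Stabℤ : ∀ g x → coset m (stab m X) g x → Stabℤ (toℤ x - toℤ g)
  coset⇒Stabℤ g x c = reduce (subst (stab m X) (fromℤ-− x g) c)

  Stabℤ⇒coset : ∀ g x → Stabℤ (toℤ x - toℤ g) → coset m (stab m X) g x
  Stabℤ⇒coset g x (reduce s) = subst (stab m X) (sym (fromℤ-− x g)) s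

module Powers (m : ℕ) {{_ : NonZero m}} (r : ℤ) (p : ℕ) (r^p≈1 : Congruence._≈_ m (r ^ p) 1ℤ) where
  open Congruence m

  r^[n*p]≈1 : ∀ n → r ^ (n ℕ.* p) ≈ 1ℤ
  r^[n*p]≈1 n = begin
    r ^ (n ℕ.* p)  ≡⟨ cong (r ^_) (ℕ.*-comm n p) ⟩
    r ^ (p ℕ.* n)  ≡⟨ ℤ.^-*-assoc r p n ⟨
    (r ^ p) ^ n    ≈⟨ ^-cong n r^p≈1 ⟩
    1ℤ ^ n         ≡⟨ ℤ.^-zeroˡ n ⟩
    1ℤ             ∎
    where open ≈-Reasoning

  r-unit : .{{NonZero p}} → IsUnit r
  r-unit = r ^ ℕ.pred p , (begin
    r ^ ℕ.pred p * r   ≡⟨ ℤ.*-comm (r ^ ℕ.pred p) r ⟩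
    r ^ suc (ℕ.pred p) ≡⟨ cong (r ^_) (ℕ.suc-pred p) ⟩
    r ^ p              ≈⟨ r^p≈1 ⟩
    1ℤ                 ∎)
    where open ≈-Reasoning

  -- Bézout gives d y = 1 ± x p, so r^(d y) ≡ r^(±1), and r^d - 1 divides r^(d y) - 1, which is a
  -- unit multiple of r - 1.
  r^d-1-unit : Prime p → IsUnit (r - 1ℤ) → ∀ {d} → 0 < d → d < p → IsUnit (r ^ d - 1ℤ)
  r^d-1-unit p-prime r-1-unit {d} 0<d d<p
    with coprime-Bézout (prime⇒coprime p-prime {{ℕ.>-nonZero 0<d}} d<p)
  ... | Bézout.+- x y 1+yd≡xp =
    unit-factorʳ (r * geometric R y) (unit-resp (≈-sym product≈1-r) (unit-neg r-1-unit))
    where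
    R = r ^ d
    regroup : ∀ R r g → r * g * (R - 1ℤ) ≡ r * ((R - 1ℤ) * g)
    regroup = solve-∀
    expand : ∀ r h → r * (h - 1ℤ) ≡ r * h - r
    expand = solve-∀
    negate : ∀ r → 1ℤ - r ≡ - (r - 1ℤ)
    negate = solve-∀
    product≈1-r : r * geometric R y * (R - 1ℤ) ≈ - (r - 1ℤ)
    product≈1-r = begin
      r * geometric R y * (R - 1ℤ)   ≡⟨ regroup R r (geometric R y) ⟩
      r * ((R - 1ℤ) * geometric R y) ≡⟨ cong (r *_) (geometric-sum R y) ⟩
      r * (R ^ y - 1ℤ)               ≡⟨ expand r (R ^ y) ⟩
      r * R ^ y - r                  ≡⟨ cong (λ z → r * z - r) (ℤ.^-*-assoc r d y) ⟩
      r ^ suc (d ℕ.* y) - r          ≡⟨ cong (λ n → r ^ n - r) (trans (cong suc (ℕ.*-comm d y)) 1+yd≡xp) ⟩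
      r ^ (x ℕ.* p) - r              ≈⟨ +-congʳ (- r) (r^[n*p]≈1 x) ⟩
      1ℤ - r                         ≡⟨ negate r ⟩
      - (r - 1ℤ)                     ∎
      where open ≈-Reasoning
  ... | Bézout.-+ x y 1+xp≡yd =
    unit-factorʳ (geometric R y) (unit-resp (≈-sym product≈r-1) r-1-unit)
    where
    R = r ^ d
    product≈r-1 : geometric R y * (R - 1ℤ) ≈ r - 1ℤ
    product≈r-1 = begin
      geometric R y * (R - 1ℤ) ≡⟨ trans (ℤ.*-comm (geometric R y) (R - 1ℤ)) (geometric-sum R y) ⟩
      R ^ y - 1ℤ               ≡⟨ cong (_- 1ℤ) (ℤ.^-*-assoc r d y) ⟩
      r ^ (d ℕ.* y) - 1ℤ       ≡⟨ cong (λ n → r ^ n - 1ℤ) (trans (ℕ.*-comm d y) (sym 1+xp≡yd)) ⟩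
      r * r ^ (x ℕ.* p) - 1ℤ   ≈⟨ +-congʳ (- 1ℤ) (*-congˡ r (r^[n*p]≈1 x)) ⟩
      r * 1ℤ - 1ℤ              ≡⟨ cong (_- 1ℤ) (ℤ.*-identityʳ r) ⟩
      r - 1ℤ                   ∎
      where open ≈-Reasoning

module Lemma5p1 (p m : ℕ) {{_ : NonZero m}} (r : ℤ) (p-prime : Prime p)
  (r^p≈1 : Congruence._≈_ m (r ^ p) 1ℤ) (r-1-unit : Congruence.IsUnit m (r - 1ℤ))
  (t : ℕ) (1≤t : 1 ≤ t) (k : Fin t → ℕ) (k-increasing : StrictlyIncreasing k) (k<p : ∀ j → k j < p)
  (ℓ : ℕ) (u : Fin ℓ → Fin m) (v : ℕ) where

  open Congruence m
  open Residues m
  open Powers m r p r^p≈1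

  A : Fin ℓ → Pred m
  A = Aset m r t k ℓ u

  open Stabiliser m (Π m ℓ A (v ∸ 1))
  open IsSubmonoid Stabℤ-isSubmonoid

  M : Pred m
  M = stab m (Π m ℓ A (v ∸ 1))

  I VM : Fin ℓ → Set
  I i  = ∀ x → A i x → M x
  VM i = Σ (Fin m) λ x → A i x × M x

  V : Fin m → Fin ℓ → Set
  V g i = Σ (Fin m) λ x → A i x × coset m M g x

  private instance
    p≢0 : NonZero p
    p≢0 = prime⇒nonZero p-prime

  Stabℤ-orbit : ∀ {w} a → Stabℤ w → Stabℤ (w * r ^ a)
  Stabℤ-orbit {w} a s = resp (≡⇒≈ (ℤ.*-comm (r ^ a) w)) (*-closed (r ^ a) s)

  Stabℤ-orbit⁻¹ : ∀ {w} a → Stabℤ (w * r ^ a) → Stabℤ w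
  Stabℤ-orbit⁻¹ {w} a s = unit-cancel (unit-^ r-unit a) (resp (≡⇒≈ (ℤ.*-comm w (r ^ a))) s)

  Stabℤ-separates : ∀ {w a b} → a < b → b < p → Stabℤ (w * r ^ a - w * r ^ b) → Stabℤ w
  Stabℤ-separates {w} {a} {b} a<b b<p s = unit-cancel c-unit (resp (≡⇒≈ factorise) s)
    where
    R = r ^ (b ∸ a)
    c-unit : IsUnit (- ((R - 1ℤ) * r ^ a))
    c-unit = unit-neg (unit-* (r^d-1-unit p-prime r-1-unit (ℕ.m<n⇒0<n∸m a<b)
                                          (ℕ.≤-<-trans (ℕ.m∸n≤m b a) b<p))
                              (unit-^ r-unit a))
    r^b≡r^a*R : r ^ b ≡ r ^ a * R
    r^b≡r^a*R = trans (cong (r ^_) (sym (ℕ.m+[n∸m]≡n (ℕ.<⇒≤ a<b)))) (ℤ.^-distribˡ-+-* r a (b ∸ a))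
    pull-out : ∀ w ra R → w * ra - w * (ra * R) ≡ - ((R - 1ℤ) * ra) * w
    pull-out = solve-∀
    factorise : w * r ^ a - w * r ^ b ≡ - ((R - 1ℤ) * r ^ a) * w
    factorise = trans (cong (λ z → w * r ^ a - w * z) r^b≡r^a*R) (pull-out w (r ^ a) R)

  coset-pw⇒Stabℤ : ∀ g a w → coset m M g (pw m r a w) → Stabℤ (toℤ w * r ^ a - toℤ g)
  coset-pw⇒Stabℤ g a w c =
    resp (+-congʳ (- toℤ g) (toℤ-fromℤ (toℤ w * r ^ a))) (coset⇒Stabℤ g (pw m r a w) c)

  coset-refl : ∀ x → coset m M x x
  coset-refl x = Stabℤ⇒coset x x (resp (≡⇒≈ (sym (ℤ.+-inverseʳ (toℤ x)))) 0∈)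

  coset-of-member : ∀ {g} → M g → SameSet m (coset m M g) M
  coset-of-member {g} Mg x = gM⊆M , M⊆gM
    where
    cancel : ∀ x g → x - g + g ≡ x
    cancel = solve-∀
    gM⊆M : coset m M g x → M x
    gM⊆M c = Stabℤ⇒stab x (resp (≡⇒≈ (cancel (toℤ x) (toℤ g)))
                                (+-closed (coset⇒Stabℤ g x c) (stab⇒Stabℤ g Mg)))
    M⊆gM : M x → coset m M g x
    M⊆gM Mx = Stabℤ⇒coset g x (−-closed (stab⇒Stabℤ x Mx) (stab⇒Stabℤ g Mg))

  V∧Stabℤ⇒M : ∀ {g i} → V g i → Stabℤ (toℤ (u i)) → M g
  V∧Stabℤ⇒M {g} {i} (_ , (j , refl) , c) s =
    Stabℤ⇒stab g (resp (≡⇒≈ (cancel (toℤ (u i) * r ^ k j) (toℤ g)))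
                        (−-closed (Stabℤ-orbit (k j) s) (coset-pw⇒Stabℤ g (k j) (u i) c)))
    where
    cancel : ∀ x g → x - (x - g) ≡ g
    cancel = solve-∀

  VM⇔I : ∀ i → (VM i → I i) × (I i → VM i)
  VM⇔I i = (λ { (_ , (j , refl) , s) _ (j′ , refl) →
                  reduced (Stabℤ-orbit (k j′) (Stabℤ-orbit⁻¹ {toℤ (u i)} (k j) (reduce s))) })
         , (λ Ii → pw m r (k j₀) (u i) , (j₀ , refl) , Ii _ (j₀ , refl))
    where
    j₀ = Fin.fromℕ< 1≤t

  V-disjoint-VM : ∀ g → ¬ M g → ∀ i → ¬ (V g i × VM i)
  V-disjoint-VM g ¬Mg i (Vgi , (_ , (j , refl) , s)) =
    ¬Mg (V∧Stabℤ⇒M Vgi (Stabℤ-orbit⁻¹ {toℤ (u i)} (k j) (reduce s)))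

  exponents-separated : ∀ {w} → ¬ Stabℤ w → ∀ j j′ → Stabℤ (w * r ^ k j - w * r ^ k j′) → j ≡ j′
  exponents-separated {w} ¬s j j′ s with Fin.<-cmp j j′
  ... | tri< j<j′ _ _ = contradiction (Stabℤ-separates (k-increasing j j′ j<j′) (k<p j′) s) ¬s
  ... | tri≈ _ j≡j′ _ = j≡j′
  ... | tri> _ _ j′<j = contradiction (Stabℤ-separates (k-increasing j′ j j′<j) (k<p j) s′) ¬s
    where
    swap : ∀ a b → - (a - b) ≡ b - a
    swap = solve-∀
    s′ : Stabℤ (w * r ^ k j′ - w * r ^ k j)
    s′ = resp (≡⇒≈ (swap (w * r ^ k j) (w * r ^ k j′))) (neg-closed s)

  orbit-cosets-distinct : ∀ {w} → ¬ Stabℤ (toℤ w) →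
                          ∀ j j′ → coset m M (pw m r (k j′) w) (pw m r (k j) w) → j ≡ j′
  orbit-cosets-distinct {w} ¬s j j′ c = exponents-separated ¬s j j′
    (resp (+-congˡ (toℤ w * r ^ k j) (neg-cong (toℤ-fromℤ (toℤ w * r ^ k j′))))
          (coset-pw⇒Stabℤ (pw m r (k j′) w) (k j) w c))

  V-outside-M : ∀ g → ¬ M g → ∀ i → V g i →
       (∀ j j′ → pw m r (k j) (u i) ≡ pw m r (k j′) (u i) → j ≡ j′) ×
       (∀ j j′ → coset m M (pw m r (k j′) (u i)) (pw m r (k j) (u i)) → j ≡ j′)
  V-outside-M g ¬Mg i Vgi =
    (λ j j′ eq → orbit-cosets-distinct ¬s j j′ (subst (λ y → coset m M y _) eq (coset-refl _)))
    , orbit-cosets-distinct ¬s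
    where
    ¬s : ¬ Stabℤ (toℤ (u i))
    ¬s = ¬Mg ∘ V∧Stabℤ⇒M Vgi

  k≡toℕ : t ≡ p → ∀ j → k j ≡ toℕ j
  k≡toℕ t≡p = strictlyIncreasing-interval 0 k-increasing (λ _ → ℕ.z≤n)
                                          (λ j → subst (k j <_) (sym t≡p) (k<p j))

  exponent-successor : t ≡ p → ∀ j → ∃ λ j′ → r ^ k j′ ≈ r * r ^ k j
  exponent-successor t≡p j with suc (toℕ j) ℕ.<? t
  ... | yes j+1<t = Fin.fromℕ< j+1<t , ≡⇒≈ (cong (r ^_) (begin
    k (Fin.fromℕ< j+1<t)    ≡⟨ k≡toℕ t≡p (Fin.fromℕ< j+1<t) ⟩
    toℕ (Fin.fromℕ< j+1<t)  ≡⟨ Fin.toℕ-fromℕ< j+1<t ⟩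
    suc (toℕ j)             ≡⟨ cong suc (k≡toℕ t≡p j) ⟨
    suc (k j)               ∎))
    where open ≡-Reasoning
  ... | no j+1≮t = j₀ , (begin
    r ^ k j₀        ≡⟨ cong (r ^_) (trans (k≡toℕ t≡p j₀) (Fin.toℕ-fromℕ< 1≤t)) ⟩
    1ℤ              ≈⟨ r^p≈1 ⟨
    r ^ p           ≡⟨ cong (r ^_) (sym 1+kⱼ≡p) ⟩
    r * r ^ k j     ∎)
    where
    open ≈-Reasoning
    j₀ = Fin.fromℕ< 1≤t
    1+kⱼ≡p : suc (k j) ≡ p
    1+kⱼ≡p = trans (cong suc (k≡toℕ t≡p j)) (trans (ℕ.≤-antisym (Fin.toℕ<n j) (ℕ.≮⇒≥ j+1≮t)) t≡p)

  V-shift : t ≡ p → ∀ {g i} → V g i → V (pw m r 1 g) i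
  V-shift t≡p {g} {i} (_ , (j , refl) , c) with exponent-successor t≡p j
  ... | j′ , r^kj′≈r·r^kj = pw m r (k j′) (u i) , (j′ , refl)
      , Stabℤ⇒coset (pw m r 1 g) (pw m r (k j′) (u i))
                    (resp shifted (*-closed r (coset-pw⇒Stabℤ g (k j) (u i) c)))
    where
    U = toℤ (u i)
    G = toℤ g
    regroup : ∀ r U s G → r * (U * s - G) ≡ U * (r * s) - G * (r * 1ℤ)
    regroup = solve-∀
    shifted : r * (U * r ^ k j - G) ≈ toℤ (pw m r (k j′) (u i)) - toℤ (pw m r 1 g)
    shifted = begin
      r * (U * r ^ k j - G)                        ≡⟨ regroup r U (r ^ k j) G ⟩
      U * (r * r ^ k j) - G * r ^ 1                ≈⟨ +-congʳ (- (G * r ^ 1)) (*-congˡ U r^kj′≈r·r^kj) ⟨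
      U * r ^ k j′ - G * r ^ 1                     ≈⟨ +-cong (toℤ-fromℤ (U * r ^ k j′))
                                                             (neg-cong (toℤ-fromℤ (G * r ^ 1))) ⟨
      toℤ (pw m r (k j′) (u i)) - toℤ (pw m r 1 g) ∎
      where open ≈-Reasoning

  heavy-coset-is-M : t ≡ p → ∀ g → AtLeast ℓ (V g) v →
                     (∀ h → AtLeast ℓ (V h) v → SameSet m (coset m M h) (coset m M g)) →
                     SameSet m (coset m M g) M
  heavy-coset-is-M t≡p g (f , f-injective , f∈V) unique = coset-of-member Mg
    where
    g′ = pw m r 1 g
    g∈g′M : coset m M g′ g
    g∈g′M = proj₂ (unique g′ (f , f-injective , λ j → V-shift t≡p {g} (f∈V j)) g) (coset-refl g)
    collect : ∀ G r → G - G * (r * 1ℤ) ≡ - (r - 1ℤ) * G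
    collect = solve-∀
    g-g′≈[1-r]g : toℤ g - toℤ g′ ≈ - (r - 1ℤ) * toℤ g
    g-g′≈[1-r]g = ≈-trans (+-congˡ (toℤ g) (neg-cong (toℤ-fromℤ (toℤ g * r ^ 1))))
                          (≡⇒≈ (collect (toℤ g) r))
    Mg : M g
    Mg = Stabℤ⇒stab g (unit-cancel (unit-neg r-1-unit) (resp g-g′≈[1-r]g (coset⇒Stabℤ g′ g g∈g′M)))

lemma5p1 : (p m : ℕ) {{_ : NonZero m}} (r : ℤ) →
  Prime p →
  (+ m) ℤD.∣ ((r ℤ.^ p) ℤ.- 1ℤ) →
  ℤG.gcd (+ p ℤ.* (r ℤ.- 1ℤ)) (+ m) ≡ 1ℤ →
  (∀ q → Prime q → q ℕD.∣ (p ℕ.* m) → p ≤ q) →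
  (t : ℕ) → 1 ≤ t → t ≤ p →
  (k : Fin t → ℕ) →
  (∀ (j : Fin t) → toℕ j ≡ 0 → k j ≡ 0) →
  (∀ (i j : Fin t) → i Fin.< j → k i < k j) →
  (∀ (j : Fin t) → k j ≤ p ∸ 1) →
  (ℓ : ℕ) (u : Fin ℓ → Fin m) →
  (v : ℕ) → 2 ≤ v → v ≤ suc ℓ →
  let A = Aset m r t k ℓ u
      M = stab m (Π m ℓ A (v ∸ 1))
      I = λ (i : Fin ℓ) → ∀ x → A i x → M x
      VM = λ (i : Fin ℓ) → Σ (Fin m) λ x → A i x × M x
      V = λ (g : Fin m) (i : Fin ℓ) → Σ (Fin m) λ x → A i x × coset m M g x
  in
  -- (i)
  ((∀ i → (VM i → I i) × (I i → VM i)) ×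
   (∀ g → ¬ M g → ∀ i → ¬ (V g i × VM i))) ×
  -- (ii)
  (∀ g → ¬ M g → ∀ i → V g i →
     (∀ j j' → pw m r (k j) (u i) ≡ pw m r (k j') (u i) → j ≡ j') ×
     (∀ j j' → coset m M (pw m r (k j') (u i)) (pw m r (k j) (u i)) → j ≡ j')) ×
  -- (iii)
  (t ≡ p → ∀ g → AtLeast ℓ (V g) v →
     (∀ h → AtLeast ℓ (V h) v → SameSet m (coset m M h) (coset m M g)) →
     SameSet m (coset m M g) M)
lemma5p1 p m r p-prime m∣r^p-1 gcd≡1 _ t 1≤t _ k _ k-increasing k≤p-1 ℓ u v _ _ =
  (VM⇔I , V-disjoint-VM) , V-outside-M , heavy-coset-is-M
  where
  open Congruence m
  instance
    p≢0 : NonZero p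
    p≢0 = prime⇒nonZero p-prime
  r-1-unit : IsUnit (r - 1ℤ)
  r-1-unit = unit-factorʳ (+ p) (coprime⇒unit (gcd≡1⇒coprime (ℤ.+-injective gcd≡1)))
  k<p : ∀ j → k j < p
  k<p j = subst (k j <_) (ℕ.suc-pred p) (ℕ.s≤s (k≤p-1 j))
  open Lemma5p1 p m r p-prime (congruent (∣ᵤ⇒∣ m∣r^p-1)) r-1-unit t 1≤t k k-increasing k<p ℓ u v
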